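{- Work in intuitionistic, predicative mathematics with countable choice ($AC_\omega$) but without the law of excluded middle. Let $L$ be a $\sigma$-frame. For $a\in L$ and $U\subseteq L$ write $a\lhd_L U$ if $a\leq\bigvee W$ for some countable subset $W\subseteq U$. Then $(L,\lhd_L)$, with the meet-semilattice structure $(\wedge,\top)$ of $L$, is a formal cover, and the corresponding frame $\mathcal{P}(L)/=_{\lhd_L}$, together with the $\sigma$-frame homomorphism $m:L\to\mathcal{P}(L)/=_{\lhd_L}$, $m(a)=[\{a\}]$, is the free frame over $L$: for every frame $Q$ and every $\sigma$-frame homomorphism $f:L\to Q$ there is a unique frame homomorphism $h:\mathcal{P}(L)/=_{\lhd_L}\to Q$ with $h\circ m=f$.
   Context: A $\sigma$-frame is a partial order (whose carrier is a set) with countable joins and finite meets in which binary meets distribute over countable joins; $\sigma$-frame homomorphisms preserve countable joins and finite meets. A subset $W$ is countable if there is $\alpha:\mathbb{N}\to W+\{*\}$ with $W\subseteq\alpha[\mathbb{N}]$. A basic cover on a set $S$ is a relation $\lhd$ between elements and subsets of $S$ such that (i) $a\lhd U$ whenever $a\in U$, and (ii) if $a\lhd U$ and $u\lhd V$ for all $u\in U$, then $a\lhd V$. A formal cover is a basic cover $(S,\lhd)$ together with a meet-semilattice structure $(S,\wedge,\top)$ such that $a\lhd\{\top\}$ for all $a$, and if $a\lhd U$ then $a\wedge b\lhd\{u\wedge b\mid u\in U\}$. The frame corresponding to a formal cover is $\mathcal{P}(S)/=_\lhd$, where $U=_\lhd V$ means $\forall a\in S.(a\lhd U\Leftrightarrow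 a\lhd V)$; it is ordered by $[U]\leq[V]$ iff $u\lhd V$ for all $u\in U$, joins are $\bigvee_i[U_i]=[\bigcup_i U_i]$, binary meets are $[U]\wedge[V]=[\{u\wedge v\mid u\in U,v\in V\}]$ and the top is $[\{\top\}]$. -}

module Defs where

open import Level using (Level; _⊔_) renaming (suc to lsuc)
open import Data.Nat using (ℕ)
open import Data.Maybe using (Maybe; just; nothing)
open import Data.Product using (Σ; _×_; _,_)
open import Relation.Binary.PropositionalEquality using (_≡_)

-- A countable subset W of the carrier is presented, as in
-- the paper, by α : ℕ → W + {*}, i.e. by α : ℕ → Maybe Carrier, with
-- W = { x | ∃ n. α n ≡ just x }.  ⋁ α is the join of that subset
-- (the empty subset, α = const nothing, gives the bottom).

_∈ᶜ_ : ∀ {ℓ} {A : Set ℓ} → A → (ℕ → Maybe A) → Set ℓ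
x ∈ᶜ α = Σ ℕ (λ n → α n ≡ just x)

mapᶜ : ∀ {ℓ} {A : Set ℓ} → (A → A) → (ℕ → Maybe A) → (ℕ → Maybe A)
mapᶜ g α n with α n
... | just x  = just (g x)
... | nothing = nothing

record σFrame (ℓ : Level) : Set (lsuc ℓ) where
  infix 4 _≤_
  infixr 7 _∧_
  field
    Carrier : Set ℓ
    _≤_     : Carrier → Carrier → Set ℓ
    ⊤       : Carrier
    _∧_     : Carrier → Carrier → Carrier
    ⋁       : (ℕ → Maybe Carrier) → Carrier
    ≤-refl    : ∀ {a} → a ≤ a
    ≤-trans   : ∀ {a b c} → a ≤ b → b ≤ c → a ≤ c
    ≤-antisym : ∀ {a b} → a ≤ b → b ≤ a → a ≡ b
    ⊤-max     : ∀ a → a ≤ ⊤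
    ∧-lb₁     : ∀ a b → a ∧ b ≤ a
    ∧-lb₂     : ∀ a b → a ∧ b ≤ b
    ∧-glb     : ∀ {a b c} → c ≤ a → c ≤ b → c ≤ a ∧ b
    ⋁-ub      : ∀ α x → x ∈ᶜ α → x ≤ ⋁ α
    ⋁-least   : ∀ α b → (∀ x → x ∈ᶜ α → x ≤ b) → ⋁ α ≤ b
    distrib   : ∀ a α → a ∧ ⋁ α ≡ ⋁ (mapᶜ (a ∧_) α)

-- Frames (predicative): a carrier with a preorder whose induced
-- equivalence (mutual ≤) is the equality of the frame (so the poset is
-- the quotient), joins of all families indexed by types in Set ι,
-- finite meets, and the infinite distributive law.

record FrameOps (c r ι : Level) : Set (lsuc (c ⊔ r ⊔ ι)) where
  infix 4 _≤_ _≈_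
  infixr 7 _∧_
  field
    Carrier : Set c
    _≤_     : Carrier → Carrier → Set r
    ⊤       : Carrier
    _∧_     : Carrier → Carrier → Carrier
    ⋁       : {I : Set ι} → (I → Carrier) → Carrier
  _≈_ : Carrier → Carrier → Set r
  a ≈ b = (a ≤ b) × (b ≤ a)

record IsFrame {c r ι} (F : FrameOps c r ι) : Set (c ⊔ r ⊔ lsuc ι) where
  open FrameOps F
  field
    ≤-refl  : ∀ {a} → a ≤ a
    ≤-trans : ∀ {a b d} → a ≤ b → b ≤ d → a ≤ d
    ⊤-max   : ∀ a → a ≤ ⊤
    ∧-lb₁   : ∀ a b → a ∧ b ≤ a
    ∧-lb₂   : ∀ a b → a ∧ b ≤ b
    ∧-glb   : ∀ {a b d} → d ≤ a → d ≤ b → d ≤ a ∧ b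
    ⋁-ub    : ∀ {I : Set ι} (g : I → Carrier) (i : I) → g i ≤ ⋁ g
    ⋁-least : ∀ {I : Set ι} (g : I → Carrier) b → (∀ i → g i ≤ b) → ⋁ g ≤ b
    distrib : ∀ a {I : Set ι} (g : I → Carrier) → a ∧ ⋁ g ≈ ⋁ (λ i → a ∧ g i)

record IsFrameHom {c r c' r' ι} (P : FrameOps c r ι) (Q : FrameOps c' r' ι)
                  (h : FrameOps.Carrier P → FrameOps.Carrier Q)
                  : Set (c ⊔ r ⊔ r' ⊔ lsuc ι) where
  private
    module P = FrameOps P
    module Q = FrameOps Q
  field
    cong   : ∀ {a b} → a P.≈ b → h a Q.≈ h b
    pres-⊤ : h P.⊤ Q.≈ Q.⊤
    pres-∧ : ∀ a b → h (a P.∧ b) Q.≈ (h a Q.∧ h b)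
    pres-⋁ : ∀ {I : Set ι} (g : I → P.Carrier) → h (P.⋁ g) Q.≈ Q.⋁ (λ i → h (g i))

record IsσHom {ℓ c r} (L : σFrame ℓ) (Q : FrameOps c r ℓ)
              (f : σFrame.Carrier L → FrameOps.Carrier Q) : Set (ℓ ⊔ r) where
  private
    module L = σFrame L
    module Q = FrameOps Q
  field
    pres-⊤ : f L.⊤ Q.≈ Q.⊤
    pres-∧ : ∀ a b → f (a L.∧ b) Q.≈ (f a Q.∧ f b)
    pres-⋁ : ∀ α → f (L.⋁ α) Q.≈ Q.⋁ {Σ L.Carrier (λ x → x ∈ᶜ α)} (λ { (x , _) → f x })

record IsFormalCover {ℓ ℓ'} (S : Set ℓ) (_◁_ : S → (S → Set ℓ) → Set ℓ')
                     (_∧_ : S → S → S) (⊤ : S) : Set (lsuc ℓ ⊔ ℓ') where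
  field
    reflexivity  : ∀ a (U : S → Set ℓ) → U a → a ◁ U
    transitivity : ∀ a (U V : S → Set ℓ) → a ◁ U → (∀ u → U u → u ◁ V) → a ◁ V
    ∧-assoc : ∀ a b d → (a ∧ b) ∧ d ≡ a ∧ (b ∧ d)
    ∧-comm  : ∀ a b → a ∧ b ≡ b ∧ a
    ∧-idem  : ∀ a → a ∧ a ≡ a
    ∧-unit  : ∀ a → a ∧ ⊤ ≡ a
    top       : ∀ a → a ◁ (λ x → x ≡ ⊤)
    stability : ∀ a b (U : S → Set ℓ) → a ◁ U →
                (a ∧ b) ◁ (λ x → Σ S (λ u → U u × x ≡ u ∧ b))

module _ {ℓ} (L : σFrame ℓ) where
  open σFrame L

  _◁L_ : Carrier → (Carrier → Set ℓ) → Set ℓ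
  a ◁L U = Σ (ℕ → Maybe Carrier) (λ α → (∀ x → x ∈ᶜ α → U x) × a ≤ ⋁ α)

  -- P(L)/=◁ : carrier = subsets of L, equality = mutual ≤ (i.e. =◁)
  coverFrame : FrameOps (lsuc ℓ) ℓ ℓ
  coverFrame = record
    { Carrier = Carrier → Set ℓ
    ; _≤_     = λ U V → ∀ u → U u → u ◁L V
    ; ⊤       = λ x → x ≡ ⊤
    ; _∧_     = λ U V x → Σ Carrier (λ u → Σ Carrier (λ v → U u × V v × x ≡ u ∧ v))
    ; ⋁       = λ {I} Us x → Σ I (λ i → Us i x)
    }

  m : Carrier → (Carrier → Set ℓ)
  m a = λ x → x ≡ a

-- The cover ◁_L is transitive because, by countable choice, a countable
-- union of countable subsets is again countable (via an enumeration of
-- ℕ × ℕ); stability is the σ-frame distributive law.  The extension of a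
-- σ-frame homomorphism f : L → Q is h U = ⋁_{u ∈ U} f u: it is monotone
-- for ◁_L because f preserves countable joins, and it is forced, since
-- every U is the join of the m u with u ∈ U.
module Submission where

open import Defs
open import Level using (Level)
open import Data.Product using (Σ; _×_; _,_; proj₁; proj₂)
open import Data.Nat using (ℕ; zero; suc; _+_)
open import Data.Nat.Properties using (+-suc; +-identityʳ)
open import Data.Maybe using (Maybe; just; nothing)
open import Data.Maybe.Properties using (just-injective)
open import Function using (_∘_)
open import Relation.Unary using (_⊆_)
open import Relation.Binary.Lattice using (BoundedMeetSemilattice)
import Relation.Binary.Lattice.Properties.MeetSemilattice as MeetSemilatticeProperties
import Relation.Binary.Lattice.Properties.BoundedMeetSemilattice as BoundedMeetSemilatticeProperties
import Relation.Binary.Reasoning.PartialOrder as PosetReasoning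
open import Relation.Binary.PropositionalEquality
  using (_≡_; refl; sym; cong; subst; isEquivalence; module ≡-Reasoning)

-- unpair walks through ℕ × ℕ along the anti-diagonals n + k = d.
next : ℕ × ℕ → ℕ × ℕ
next (zero  , k) = suc k , zero
next (suc n , k) = n , suc k

unpair : ℕ → ℕ × ℕ
unpair zero    = zero , zero
unpair (suc i) = next (unpair i)

private
  Reached : ℕ × ℕ → Set
  Reached p = Σ ℕ λ i → unpair i ≡ p

  step : ∀ {p} → Reached p → Reached (next p)
  step (i , e) = suc i , cong next e

  walk : ∀ k {n m} → Reached (k + n , m) → Reached (n , m + k)
  walk zero    {n} {m} r = subst (λ j → Reached (n , j)) (sym (+-identityʳ m)) r
  walk (suc k) {n} {m} r = subst (λ j → Reached (n , j)) (sym (+-suc m k)) (walk k (step r))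

  diagonal : ∀ d → Reached (d , zero)
  diagonal zero    = zero , refl
  diagonal (suc d) = step (walk d (subst (λ j → Reached (j , zero)) (sym (+-identityʳ d)) (diagonal d)))

unpair-surjective : ∀ n k → Σ ℕ λ i → unpair i ≡ (n , k)
unpair-surjective n k = walk k (diagonal (k + n))

module _ {a} {A : Set a} where

  singletonᶜ : A → ℕ → Maybe A
  singletonᶜ x _ = just x

  ∈-singletonᶜ⁻ : ∀ {x y} → y ∈ᶜ singletonᶜ x → y ≡ x
  ∈-singletonᶜ⁻ (_ , e) = sym (just-injective e)

  ∈-mapᶜ⁺ : ∀ (g : A → A) {α x} → x ∈ᶜ α → g x ∈ᶜ mapᶜ g α
  ∈-mapᶜ⁺ g {α} {x} (n , e) = n , lemma
    where
    lemma : mapᶜ g α n ≡ just (g x)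
    lemma rewrite e = refl

  ∈-mapᶜ⁻ : ∀ (g : A → A) {α y} → y ∈ᶜ mapᶜ g α → Σ A λ x → x ∈ᶜ α × y ≡ g x
  ∈-mapᶜ⁻ g {α} (n , e) with α n in eq
  ∈-mapᶜ⁻ g {α} (n , refl) | just x = x , (n , eq) , refl

  -- A countable family indexed by the countable set α; each member may depend
  -- on the proof of membership in α, as the covers chosen in ◁-trans do.
  CountableFamily : (ℕ → Maybe A) → Set a
  CountableFamily α = ∀ x → x ∈ᶜ α → ℕ → Maybe A

  module _ (α : ℕ → Maybe A) (β : CountableFamily α) where

    private
      component : ∀ n mx → α n ≡ mx → ℕ → Maybe A
      component n (just x) e = β x (n , e)
      component n nothing  _ = λ _ → nothing

      component-≡ : ∀ n mx (e : α n ≡ mx) → component n (α n) refl ≡ component n mx e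
      component-≡ n _ refl = refl

      ∈-component⁻ : ∀ n mx (e : α n ≡ mx) {k y} → component n mx e k ≡ just y →
                     Σ A λ x → Σ (x ∈ᶜ α) λ p → y ∈ᶜ β x p
      ∈-component⁻ n (just x) e {k} e' = x , (n , e) , (k , e')

      pick : ℕ × ℕ → Maybe A
      pick (n , k) = component n (α n) refl k

    ⋃ᶜ : ℕ → Maybe A
    ⋃ᶜ i = pick (unpair i)

    ∈-⋃ᶜ⁺ : ∀ {x y} (p : x ∈ᶜ α) → y ∈ᶜ β x p → y ∈ᶜ ⋃ᶜ
    ∈-⋃ᶜ⁺ {x} {y} (n , e) (k , e') with unpair-surjective n k
    ... | i , eᵢ = i , (begin
      pick (unpair i)          ≡⟨ cong pick eᵢ ⟩
      component n (α n) refl k ≡⟨ cong (λ c → c k) (component-≡ n (just x) e) ⟩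
      β x (n , e) k            ≡⟨ e' ⟩
      just y                   ∎)
      where open ≡-Reasoning

    ∈-⋃ᶜ⁻ : ∀ {y} → y ∈ᶜ ⋃ᶜ → Σ A λ x → Σ (x ∈ᶜ α) λ p → y ∈ᶜ β x p
    ∈-⋃ᶜ⁻ (i , e) = ∈-component⁻ (proj₁ (unpair i)) _ refl e

module σFrameProperties {ℓ} (L : σFrame ℓ) where
  open σFrame L
  private
    module CF = FrameOps (coverFrame L)

  ≤-reflexive : ∀ {a b} → a ≡ b → a ≤ b
  ≤-reflexive refl = ≤-refl

  boundedMeetSemilattice : BoundedMeetSemilattice ℓ ℓ ℓ
  boundedMeetSemilattice = record
    { _≈_ = _≡_
    ; _≤_ = _≤_
    ; _∧_ = _∧_
    ; ⊤   = ⊤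
    ; isBoundedMeetSemilattice = record
      { isMeetSemilattice = record
        { isPartialOrder = record
          { isPreorder = record
            { isEquivalence = isEquivalence ; reflexive = ≤-reflexive ; trans = ≤-trans }
          ; antisym = ≤-antisym
          }
        ; infimum = λ a b → ∧-lb₁ a b , ∧-lb₂ a b , λ _ → ∧-glb
        }
      ; maximum = ⊤-max
      }
    }

  open BoundedMeetSemilattice boundedMeetSemilattice using (meetSemilattice; poset)
  open MeetSemilatticeProperties meetSemilattice
    using (∧-comm; ∧-assoc; ∧-idempotent; ∧-monotonic; y≤x⇒x∧y≈y) public
  open BoundedMeetSemilatticeProperties boundedMeetSemilattice using (identityʳ) public

  infix 4 _◁_
  private
    _◁_ : Carrier → (Carrier → Set ℓ) → Set ℓ
    _◁_ = _◁L_ L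

  ◁-reflexive : ∀ {a} {U : Carrier → Set ℓ} → U a → a ◁ U
  ◁-reflexive {a} {U} Ua = singletonᶜ a , (λ x x∈a → subst U (sym (∈-singletonᶜ⁻ x∈a)) Ua)
                                        , ⋁-ub (singletonᶜ a) a (0 , refl)

  ≤-◁-trans : ∀ {a b} {U : Carrier → Set ℓ} → a ≤ b → b ◁ U → a ◁ U
  ≤-◁-trans a≤b (α , α⊆U , b≤⋁α) = α , α⊆U , ≤-trans a≤b b≤⋁α

  ◁-mono : ∀ {a} {U V : Carrier → Set ℓ} → U ⊆ V → a ◁ U → a ◁ V
  ◁-mono U⊆V (α , α⊆U , a≤⋁α) = α , (λ x x∈α → U⊆V (α⊆U x x∈α)) , a≤⋁α

  -- Countable choice is the function cov: it picks a countable cover of each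
  -- element of α, and these are glued into one countable subset of V.
  ◁-trans : ∀ {a} {U V : Carrier → Set ℓ} → a ◁ U → (∀ u → U u → u ◁ V) → a ◁ V
  ◁-trans {a} {U} {V} (α , α⊆U , a≤⋁α) cov = γ , γ⊆V , ≤-trans a≤⋁α (⋁-least α (⋁ γ) α≤⋁γ)
    where
    β : CountableFamily α
    β x x∈α = proj₁ (cov x (α⊆U x x∈α))

    γ : ℕ → Maybe Carrier
    γ = ⋃ᶜ α β

    γ⊆V : ∀ y → y ∈ᶜ γ → V y
    γ⊆V y y∈γ with ∈-⋃ᶜ⁻ α β y∈γ
    ... | x , x∈α , y∈βx = proj₁ (proj₂ (cov x (α⊆U x x∈α))) y y∈βx

    α≤⋁γ : ∀ x → x ∈ᶜ α → x ≤ ⋁ γ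
    α≤⋁γ x x∈α = ≤-trans (proj₂ (proj₂ (cov x (α⊆U x x∈α))))
                         (⋁-least (β x x∈α) (⋁ γ) (λ y y∈βx → ⋁-ub γ y (∈-⋃ᶜ⁺ α β x∈α y∈βx)))

  ◁-stable : ∀ {a} b {U : Carrier → Set ℓ} → a ◁ U →
             a ∧ b ◁ (λ x → Σ Carrier λ u → U u × x ≡ u ∧ b)
  ◁-stable {a} b {U} (α , α⊆U , a≤⋁α) = mapᶜ (_∧ b) α , ⊆U∧b , (begin
      a ∧ b                 ≤⟨ ∧-monotonic a≤⋁α ≤-refl ⟩
      ⋁ α ∧ b               ≡⟨ ∧-comm (⋁ α) b ⟩
      b ∧ ⋁ α               ≡⟨ distrib b α ⟩
      ⋁ (mapᶜ (b ∧_) α)     ≤⟨ ⋁-least _ _ b∧α≤ ⟩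
      ⋁ (mapᶜ (_∧ b) α)     ∎)
    where
    open PosetReasoning poset

    ⊆U∧b : ∀ x → x ∈ᶜ mapᶜ (_∧ b) α → Σ Carrier λ u → U u × x ≡ u ∧ b
    ⊆U∧b x x∈α∧b with ∈-mapᶜ⁻ (_∧ b) x∈α∧b
    ... | u , u∈α , refl = u , α⊆U u u∈α , refl

    b∧α≤ : ∀ x → x ∈ᶜ mapᶜ (b ∧_) α → x ≤ ⋁ (mapᶜ (_∧ b) α)
    b∧α≤ x x∈b∧α with ∈-mapᶜ⁻ (b ∧_) x∈b∧α
    ... | u , u∈α , refl = ≤-trans (≤-reflexive (∧-comm b u)) (⋁-ub _ _ (∈-mapᶜ⁺ (_∧ b) u∈α))

  ◁-∧ : ∀ {a b} {U V : Carrier → Set ℓ} → a ◁ U → b ◁ V → a ∧ b ◁ (U CF.∧ V)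
  ◁-∧ {a} {b} {U} {V} a◁U b◁V = ◁-trans (◁-stable b a◁U) u∧b◁U∧V
    where
    u∧b◁U∧V : ∀ x → (Σ Carrier λ u → U u × x ≡ u ∧ b) → x ◁ (U CF.∧ V)
    u∧b◁U∧V x (u , Uu , refl) =
      ≤-◁-trans (≤-reflexive (∧-comm u b))
        (◁-mono (λ { (v , Vv , refl) → u , v , Uu , Vv , ∧-comm v u }) (◁-stable u b◁V))

  isFormalCover : IsFormalCover Carrier _◁_ _∧_ ⊤
  isFormalCover = record
    { reflexivity  = λ _ _ → ◁-reflexive
    ; transitivity = λ _ _ _ → ◁-trans
    ; ∧-assoc      = ∧-assoc
    ; ∧-comm       = ∧-comm
    ; ∧-idem       = ∧-idempotent
    ; ∧-unit       = identityʳ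
    ; top          = λ a → ≤-◁-trans (⊤-max a) (◁-reflexive refl)
    ; stability    = λ _ b _ → ◁-stable b
    }

  coverFrame-isFrame : IsFrame (coverFrame L)
  coverFrame-isFrame = record
    { ≤-refl  = λ _ → ◁-reflexive
    ; ≤-trans = λ U≤V V≤W u Uu → ◁-trans (U≤V u Uu) V≤W
    ; ⊤-max   = λ _ u _ → ≤-◁-trans (⊤-max u) (◁-reflexive refl)
    ; ∧-lb₁   = λ { _ _ _ (u , v , Uu , _ , refl) → ≤-◁-trans (∧-lb₁ u v) (◁-reflexive Uu) }
    ; ∧-lb₂   = λ { _ _ _ (u , v , _ , Vv , refl) → ≤-◁-trans (∧-lb₂ u v) (◁-reflexive Vv) }
    ; ∧-glb   = λ W≤U W≤V w Ww →
        subst (_◁ _) (∧-idempotent w) (◁-∧ (W≤U w Ww) (W≤V w Ww))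
    ; ⋁-ub    = λ _ i _ Uᵢx → ◁-reflexive (i , Uᵢx)
    ; ⋁-least = λ _ _ Uᵢ≤V x (i , Uᵢx) → Uᵢ≤V i x Uᵢx
    ; distrib = λ _ _ →
        (λ { _ (u , v , Uu , (i , Vᵢv) , e) → ◁-reflexive (i , u , v , Uu , Vᵢv , e) })
      , (λ { _ (i , u , v , Uu , Vᵢv , e) → ◁-reflexive (u , v , Uu , (i , Vᵢv) , e) })
    }

  m-isσHom : IsσHom L (coverFrame L) (m L)
  m-isσHom = record
    { pres-⊤ = (λ _ → ◁-reflexive) , (λ _ → ◁-reflexive)
    ; pres-∧ = λ a b →
        (λ _ e → ◁-reflexive (a , b , refl , refl , e))
      , (λ { _ (u , v , refl , refl , e) → ◁-reflexive e })
    ; pres-⋁ = λ α →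
        (λ { _ refl → α , (λ y y∈α → (y , y∈α) , refl) , ≤-refl })
      , (λ { _ ((x , x∈α) , refl) → ≤-◁-trans (⋁-ub α x x∈α) (◁-reflexive refl) })
    }

  ⋁-m : ∀ (U : Carrier → Set ℓ) → U CF.≈ CF.⋁ {Σ Carrier U} (m L ∘ proj₁)
  ⋁-m U = (λ u Uu → ◁-reflexive ((u , Uu) , refl))
        , (λ { _ ((u , Uu) , refl) → ◁-reflexive Uu })

module FrameProperties {c r ι} (Q : FrameOps c r ι) (isFrame : IsFrame Q) where
  open FrameOps Q
  open IsFrame isFrame

  boundedMeetSemilattice : BoundedMeetSemilattice c r r
  boundedMeetSemilattice = record
    { _≈_ = _≈_
    ; _≤_ = _≤_
    ; _∧_ = _∧_
    ; ⊤   = ⊤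
    ; isBoundedMeetSemilattice = record
      { isMeetSemilattice = record
        { isPartialOrder = record
          { isPreorder = record
            { isEquivalence = record
              { refl  = ≤-refl , ≤-refl
              ; sym   = λ (a≤b , b≤a) → b≤a , a≤b
              ; trans = λ (a≤b , b≤a) (b≤d , d≤b) → ≤-trans a≤b b≤d , ≤-trans d≤b b≤a
              }
            ; reflexive = proj₁
            ; trans     = ≤-trans
            }
          ; antisym = _,_
          }
        ; infimum = λ a b → ∧-lb₁ a b , ∧-lb₂ a b , λ _ → ∧-glb
        }
      ; maximum = ⊤-max
      }
    }

  open BoundedMeetSemilattice boundedMeetSemilattice using (meetSemilattice; poset) public
  open MeetSemilatticeProperties meetSemilattice using (∧-comm; ∧-monotonic) public

  ⋁-cong : ∀ {I : Set ι} {g g' : I → Carrier} → (∀ i → g i ≈ g' i) → ⋁ g ≈ ⋁ g'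
  ⋁-cong {g = g} {g'} g≈g' = ⋁-least g _ (λ i → ≤-trans (proj₁ (g≈g' i)) (⋁-ub g' i))
                           , ⋁-least g' _ (λ i → ≤-trans (proj₂ (g≈g' i)) (⋁-ub g i))

  ⋁∧⋁-least : ∀ {I J : Set ι} (g : I → Carrier) (g' : J → Carrier) b →
              (∀ i j → g i ∧ g' j ≤ b) → ⋁ g ∧ ⋁ g' ≤ b
  ⋁∧⋁-least g g' b g∧g'≤b = begin
      ⋁ g ∧ ⋁ g'               ≤⟨ proj₁ (distrib (⋁ g) g') ⟩
      ⋁ (λ j → ⋁ g ∧ g' j)     ≤⟨ ⋁-least _ b ⋁g∧g'≤b ⟩
      b                        ∎
    where
    open PosetReasoning poset

    ⋁g∧g'≤b : ∀ j → ⋁ g ∧ g' j ≤ b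
    ⋁g∧g'≤b j = begin
      ⋁ g ∧ g' j               ≈⟨ ∧-comm (⋁ g) (g' j) ⟩
      g' j ∧ ⋁ g               ≤⟨ proj₁ (distrib (g' j) g) ⟩
      ⋁ (λ i → g' j ∧ g i)     ≤⟨ ⋁-least _ b (λ i → ≤-trans (proj₁ (∧-comm (g' j) (g i))) (g∧g'≤b i j)) ⟩
      b                        ∎

module FreeFrame {ℓ c r} (L : σFrame ℓ) (Q : FrameOps c r ℓ) (isFrame : IsFrame Q)
                 (f : σFrame.Carrier L → FrameOps.Carrier Q) (f-isσHom : IsσHom L Q f) where
  private
    module L = σFrame L
    module LP = σFrameProperties L
    module CF = FrameOps (coverFrame L)
    module Q = FrameOps Q
    module f = IsσHom f-isσHom
  open IsFrame isFrame
  open FrameProperties Q isFrame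
  open PosetReasoning poset

  extend : CF.Carrier → Q.Carrier
  extend U = Q.⋁ {Σ L.Carrier U} (f ∘ proj₁)

  f-monotone : ∀ {a b} → a L.≤ b → f a Q.≤ f b
  f-monotone {a} {b} a≤b = begin
    f a              ≡⟨ cong f (sym (LP.y≤x⇒x∧y≈y a≤b)) ⟩
    f (b L.∧ a)      ≈⟨ f.pres-∧ b a ⟩
    f b Q.∧ f a      ≤⟨ ∧-lb₁ (f b) (f a) ⟩
    f b              ∎

  ◁-extend : ∀ {a V} → _◁L_ L a V → f a Q.≤ extend V
  ◁-extend {a} {V} (α , α⊆V , a≤⋁α) = begin
    f a                                       ≤⟨ f-monotone a≤⋁α ⟩
    f (L.⋁ α)                                 ≈⟨ f.pres-⋁ α ⟩
    Q.⋁ {Σ L.Carrier (_∈ᶜ α)} (f ∘ proj₁)     ≤⟨ ⋁-least _ _ (λ (x , x∈α) → ⋁-ub (f ∘ proj₁) (x , α⊆V x x∈α)) ⟩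
    extend V                                  ∎

  extend-monotone : ∀ {U V} → U CF.≤ V → extend U Q.≤ extend V
  extend-monotone U≤V = ⋁-least _ _ (λ (u , Uu) → ◁-extend (U≤V u Uu))

  extend-isFrameHom : IsFrameHom (coverFrame L) Q extend
  extend-isFrameHom = record
    { cong   = λ (U≤V , V≤U) → extend-monotone U≤V , extend-monotone V≤U
    ; pres-⊤ = ⊤-max _ , ≤-trans (proj₂ f.pres-⊤) (⋁-ub (f ∘ proj₁) (L.⊤ , refl))
    ; pres-∧ = λ U V →
        ⋁-least _ _ (λ { (_ , u , v , Uu , Vv , refl) → begin
          f (u L.∧ v)        ≈⟨ f.pres-∧ u v ⟩
          f u Q.∧ f v        ≤⟨ ∧-monotonic (⋁-ub (f ∘ proj₁) (u , Uu)) (⋁-ub (f ∘ proj₁) (v , Vv)) ⟩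
          extend U Q.∧ extend V ∎ })
      , ⋁∧⋁-least _ _ _ (λ (u , Uu) (v , Vv) → begin
          f u Q.∧ f v        ≈⟨ f.pres-∧ u v ⟨
          f (u L.∧ v)        ≤⟨ ⋁-ub (f ∘ proj₁) (u L.∧ v , u , v , Uu , Vv , refl) ⟩
          extend (U CF.∧ V)  ∎)
    ; pres-⋁ = λ Us →
        ⋁-least _ _ (λ (x , i , Uᵢx) → ≤-trans (⋁-ub (f ∘ proj₁) (x , Uᵢx)) (⋁-ub (extend ∘ Us) i))
      , ⋁-least _ _ (λ i → extend-monotone (IsFrame.⋁-ub LP.coverFrame-isFrame Us i))
    }

  extend-m : ∀ a → extend (m L a) Q.≈ f a
  extend-m a = ⋁-least _ _ (λ { (_ , refl) → ≤-refl }) , ⋁-ub (f ∘ proj₁) (a , refl)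

  extend-unique : ∀ (h : CF.Carrier → Q.Carrier) → IsFrameHom (coverFrame L) Q h →
                  (∀ a → h (m L a) Q.≈ f a) → ∀ U → h U Q.≈ extend U
  extend-unique h h-isFrameHom h∘m≈f U = begin-equality
    h U                                       ≈⟨ H.cong (LP.⋁-m U) ⟩
    h (CF.⋁ {Σ L.Carrier U} (m L ∘ proj₁))    ≈⟨ H.pres-⋁ (m L ∘ proj₁) ⟩
    Q.⋁ (h ∘ m L ∘ proj₁)                     ≈⟨ ⋁-cong (h∘m≈f ∘ proj₁) ⟩
    extend U                                  ∎
    where module H = IsFrameHom h-isFrameHom

mainTheorem5 : ∀ {ℓ c r : Level} (L : σFrame ℓ) →
    IsFormalCover (σFrame.Carrier L) (_◁L_ L) (σFrame._∧_ L) (σFrame.⊤ L)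
    × IsFrame (coverFrame L)
    × IsσHom L (coverFrame L) (m L)
    × ((Q : FrameOps c r ℓ) → IsFrame Q →
       (f : σFrame.Carrier L → FrameOps.Carrier Q) → IsσHom L Q f →
       Σ (FrameOps.Carrier (coverFrame L) → FrameOps.Carrier Q) (λ h →
         IsFrameHom (coverFrame L) Q h
         × (∀ a → FrameOps._≈_ Q (h (m L a)) (f a))
         × (∀ (h' : FrameOps.Carrier (coverFrame L) → FrameOps.Carrier Q) →
              IsFrameHom (coverFrame L) Q h' →
              (∀ a → FrameOps._≈_ Q (h' (m L a)) (f a)) →
              ∀ U → FrameOps._≈_ Q (h' U) (h U))))
mainTheorem5 L = isFormalCover , coverFrame-isFrame , m-isσHom ,
  λ Q isFrame f f-isσHom →
    let open FreeFrame L Q isFrame f f-isσHom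
    in  extend , extend-isFrameHom , extend-m , extend-unique
  where open σFrameProperties L
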